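{- Let $c(k):=\sum_{r=1}^{k} \frac{t(k,r)}{r}$, where the numbers $t(k,r)$ are defined by $t(k,0)=0$ for all $k$, $t(0,r)=0$ for all $r$, $t(1,1)=1$, $t(1,r)=0$ for $r\neq 1$, $t(k,r)=0$ for $r>k$, and, for $k\ge 2$ and $1\le r\le k$, $t(k,r)=\sum_{s=1}^{k} t(k-r,s)\binom{2s-1}{r-1}$. Then $$\lim_{k\to\infty}\sqrt[k]{c(k)}=4.$$ -}

module Defs where

open import Data.Nat using (ℕ; zero; suc; _+_; _*_; _∸_; _<ᵇ_)
open import Data.Nat.Combinatorics using (_C_)
open import Data.Bool using (if_then_else_)
open import Data.Integer using (+_)
open import Data.Rational using (ℚ; _/_; 0ℚ; 1ℚ) renaming (_+_ to _+ℚ_; _*_ to _*ℚ_)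

sum1 : ℕ → (ℕ → ℕ) → ℕ
sum1 zero    g = 0
sum1 (suc k) g = sum1 k g + g (suc k)

-- t with fuel (first argument); fuel decreases while the row index k
-- strictly decreases (k ∸ r with r ≥ 1), so fuel k+1 is always enough.
tf : ℕ → ℕ → ℕ → ℕ
tf zero    _ _ = 0
tf (suc f) zero r = 0
tf (suc f) (suc k) zero = 0
tf (suc f) 1 1 = 1
tf (suc f) 1 (suc (suc r)) = 0
tf (suc f) (suc (suc k)) (suc r) =
  if suc (suc k) <ᵇ suc r then 0
  else sum1 (suc (suc k)) (λ s → tf f (suc (suc k) ∸ suc r) s * ((2 * s ∸ 1) C r))

t : ℕ → ℕ → ℕ
t k r = tf (suc k) k r

sum1ℚ : ℕ → ((r : ℕ) → ℚ) → ℚ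
sum1ℚ zero    g = 0ℚ
sum1ℚ (suc k) g = sum1ℚ k g +ℚ g (suc k)

c : ℕ → ℚ
c k = sum1ℚ k (λ { zero → 0ℚ ; (suc r) → (+ t k (suc r)) / suc r })

_^ℚ_ : ℚ → ℕ → ℚ
q ^ℚ zero  = 1ℚ
q ^ℚ suc n = q *ℚ (q ^ℚ n)

four : ℚ
four = (+ 4) / 1

module Submission where

-- Upper bound: t(k,r)·4^r ≤ 4^k, by induction along the recurrence.  Given this for the rows
-- below, the recurrence reduces it to Σ_{s ≤ N} 4^(-s) C(2s-1, j) ≤ 1, which follows from the
-- identity P(M+1) + C(M,j) = 2 P(M) for the partial sums P(M) = Σ_{i ≤ j} C(M,i).  Hence
-- c(k) ≤ Σ_r t(k,r) < 4^k.
-- Lower bound: c(k) ≥ t(k,1).  A single summand of the recurrence gives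
-- t(L+r+1, r+1) ≥ t(L,s)·C(2s-1, r).  With s = r+1 = v+1 it multiplies an entry of column v+1
-- by C(2v+1, v) ≥ 4^(v+1) / (4(v+1)) every v+1 rows, and with r = 0 it moves any entry to the
-- first column of the next row.  So t(k,1) grows like C(2v+1,v)^(k/(v+1)), whose k-th root
-- tends to 4 as v grows; choosing v in terms of ε gives (4-ε)^k < c(k) eventually.

open import Defs

module _ where
  open import Data.Nat
  open import Data.Nat.Properties
  open import Data.Nat.Combinatorics using (_C_; nCk+nC[k+1]≡[n+1]C[k+1]; nCk≡nC[n∸k]; nC1≡n; k>n⇒nCk≡0)
  open import Data.Nat.Tactic.RingSolver using (solve-∀)
  open import Data.Nat.DivMod using (_/_; _%_; m≡m%n+[m/n]*n; m%n<n; m*n/n≡m; /-monoˡ-≤)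
  open import Algebra.Properties.CommutativeSemigroup *-commutativeSemigroup using (x∙yz≈y∙xz; interchange)
  open import Data.Product using (Σ; _×_; _,_)
  open import Data.Bool using (true; false; T; if_then_else_)
  open import Data.Sum using (inj₁; inj₂)
  open import Data.Unit using (tt)
  open import Relation.Nullary using (yes; no; contradiction)
  open import Relation.Binary.PropositionalEquality

  sum1-cong : ∀ n {g h : ℕ → ℕ} → (∀ s → g s ≡ h s) → sum1 n g ≡ sum1 n h
  sum1-cong zero    eq = refl
  sum1-cong (suc n) eq = cong₂ _+_ (sum1-cong n eq) (eq (suc n))

  term≤sum1 : ∀ n (g : ℕ → ℕ) {s} → 1 ≤ s → s ≤ n → g s ≤ sum1 n g
  term≤sum1 zero    g () z≤n
  term≤sum1 (suc n) g {s} 1≤s s≤1+n with m≤n⇒m<n∨m≡n s≤1+n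
  ... | inj₁ (s≤s s≤n) = ≤-trans (term≤sum1 n g 1≤s s≤n) (m≤m+n (sum1 n g) (g (suc n)))
  ... | inj₂ refl      = m≤n+m (g (suc n)) (sum1 n g)

  tf-fuel-irrelevant : ∀ {f g} k r → k < f → k < g → tf f k r ≡ tf g k r
  tf-fuel-irrelevant {suc f} {suc g} zero          r             _          _          = refl
  tf-fuel-irrelevant {suc f} {suc g} (suc zero)    zero          _          _          = refl
  tf-fuel-irrelevant {suc f} {suc g} (suc zero)    (suc zero)    _          _          = refl
  tf-fuel-irrelevant {suc f} {suc g} (suc zero)    (suc (suc r)) _          _          = refl
  tf-fuel-irrelevant {suc f} {suc g} (suc (suc k)) zero          _          _          = refl
  tf-fuel-irrelevant {suc f} {suc g} (suc (suc k)) (suc r)       (s≤s k<f) (s≤s k<g) =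
    cong (if suc (suc k) <ᵇ suc r then 0 else_) (sum1-cong (suc (suc k)) λ s →
      cong (_* _) (tf-fuel-irrelevant (suc k ∸ r) s (≤-<-trans (m∸n≤m (suc k) r) k<f)
                                                    (≤-<-trans (m∸n≤m (suc k) r) k<g)))

  t≡tf : ∀ {f} k r → k < f → t k r ≡ tf f k r
  t≡tf k r = tf-fuel-irrelevant k r ≤-refl

  t-zeroʳ : ∀ k → t k 0 ≡ 0
  t-zeroʳ zero    = refl
  t-zeroʳ (suc k) = refl

  t-above-diagonal : ∀ {k r} → k < r → t k r ≡ 0
  t-above-diagonal {zero}        {r}           _   = refl
  t-above-diagonal {suc zero}    {suc zero}    (s≤s ())
  t-above-diagonal {suc zero}    {suc (suc r)} _   = refl
  t-above-diagonal {suc (suc k)} {suc r}       k<r with suc (suc k) <ᵇ suc r | <⇒<ᵇ k<r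
  ... | true | _ = refl

  t-unfold : ∀ k r → suc r ≤ suc (suc k) →
    t (suc (suc k)) (suc r) ≡ sum1 (suc (suc k)) (λ s → t (suc (suc k) ∸ suc r) s * ((2 * s ∸ 1) C r))
  t-unfold k r r<2+k with suc (suc k) <ᵇ suc r in eq
  ... | true  = contradiction (<ᵇ⇒< (suc (suc k)) (suc r) (subst T (sym eq) tt)) (≤⇒≯ r<2+k)
  ... | false = sum1-cong (suc (suc k)) λ s →
    cong (_* _) (sym (t≡tf (suc k ∸ r) s (s≤s (m∸n≤m (suc k) r))))

  t-step : ∀ L r s → t L s * ((2 * s ∸ 1) C r) ≤ t (L + suc r) (suc r)
  t-step L r zero rewrite t-zeroʳ L = z≤n
  t-step L r (suc s) with suc s ≤? L
  ... | no s≰L rewrite t-above-diagonal (≰⇒> s≰L) = z≤n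
  t-step (suc L) r (suc s) | yes s≤L = begin
      term (suc L) (suc s)             ≤⟨ term≤sum1 K (term (suc L)) (s≤s z≤n) s<K ⟩
      sum1 K (term (suc L))            ≡⟨ sum1-cong K (λ s′ → cong (λ m → term m s′) (sym (m+n∸n≡m (suc L) r))) ⟩
      sum1 K (term (suc (L + r) ∸ r))  ≡⟨ sym (t-unfold (L + r) r r<K) ⟩
      t K (suc r)                      ≡⟨ cong (λ n → t (suc n) (suc r)) (sym (+-suc L r)) ⟩
      t (suc L + suc r) (suc r)        ∎
    where
    open ≤-Reasoning
    K = suc (suc (L + r))
    s<K : suc s ≤ K
    s<K = ≤-trans s≤L (≤-trans (s≤s (m≤m+n L r)) (n≤1+n _))
    r<K : suc r ≤ K
    r<K = s≤s (≤-trans (m≤n+m r L) (n≤1+n _))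
    term : ℕ → ℕ → ℕ
    term m s′ = t m s′ * ((2 * s′ ∸ 1) C r)

  -- Upper bound

  binomialPrefix : ℕ → ℕ → ℕ
  binomialPrefix M zero    = M C 0
  binomialPrefix M (suc j) = binomialPrefix M j + M C suc j

  binomialPrefix-zero : ∀ j → binomialPrefix 0 j ≡ 1
  binomialPrefix-zero zero    = refl
  binomialPrefix-zero (suc j) = trans (+-identityʳ (binomialPrefix 0 j)) (binomialPrefix-zero j)

  binomialPrefix-suc : ∀ M j → binomialPrefix (suc M) j + M C j ≡ 2 * binomialPrefix M j
  binomialPrefix-suc M zero    = refl
  binomialPrefix-suc M (suc j) = begin
    binomialPrefix (suc M) j + suc M C suc j + M C suc j
      ≡⟨ cong (λ x → binomialPrefix (suc M) j + x + M C suc j) (sym (nCk+nC[k+1]≡[n+1]C[k+1] M j)) ⟩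
    binomialPrefix (suc M) j + (M C j + M C suc j) + M C suc j
      ≡⟨ regroup (binomialPrefix (suc M) j) (M C j) (M C suc j) ⟩
    binomialPrefix (suc M) j + M C j + 2 * (M C suc j)
      ≡⟨ cong (_+ 2 * (M C suc j)) (binomialPrefix-suc M j) ⟩
    2 * binomialPrefix M j + 2 * (M C suc j)
      ≡⟨ sym (*-distribˡ-+ 2 (binomialPrefix M j) (M C suc j)) ⟩
    2 * binomialPrefix M (suc j) ∎
    where
    open ≡-Reasoning
    regroup : ∀ a b c → a + (b + c) + c ≡ a + b + 2 * c
    regroup = solve-∀

  -- oddBinomialSeries N j = Σ_{s=1}^{N} 4^(N-s) C(2s-1, j)
  oddBinomialSeries : ℕ → ℕ → ℕ
  oddBinomialSeries zero    j = 0
  oddBinomialSeries (suc N) j = 4 * oddBinomialSeries N j + suc (2 * N) C j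

  oddBinomialSeries+binomialPrefix≤4^ : ∀ N j → oddBinomialSeries N j + binomialPrefix (2 * N) j ≤ 4 ^ N
  oddBinomialSeries+binomialPrefix≤4^ zero    j = ≤-reflexive (binomialPrefix-zero j)
  oddBinomialSeries+binomialPrefix≤4^ (suc N) j = begin
    4 * F + suc M C j + binomialPrefix (2 * suc N) j
      ≡⟨ cong (λ n → 4 * F + suc M C j + binomialPrefix n j) (*-suc 2 N) ⟩
    4 * F + suc M C j + binomialPrefix (suc (suc M)) j
      ≡⟨ +-assoc (4 * F) (suc M C j) _ ⟩
    4 * F + (suc M C j + binomialPrefix (suc (suc M)) j)
      ≡⟨ cong (4 * F +_) (trans (+-comm (suc M C j) _) (binomialPrefix-suc (suc M) j)) ⟩
    4 * F + 2 * binomialPrefix (suc M) j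
      ≤⟨ +-monoʳ-≤ (4 * F) (*-monoʳ-≤ 2 (m≤m+n (binomialPrefix (suc M) j) (M C j))) ⟩
    4 * F + 2 * (binomialPrefix (suc M) j + M C j)
      ≡⟨ cong (λ x → 4 * F + 2 * x) (binomialPrefix-suc M j) ⟩
    4 * F + 2 * (2 * binomialPrefix M j)
      ≡⟨ regroup F (binomialPrefix M j) ⟩
    4 * (F + binomialPrefix M j)
      ≤⟨ *-monoʳ-≤ 4 (oddBinomialSeries+binomialPrefix≤4^ N j) ⟩
    4 * 4 ^ N ∎
    where
    open ≤-Reasoning
    F = oddBinomialSeries N j
    M = 2 * N
    regroup : ∀ a b → 4 * a + 2 * (2 * b) ≡ 4 * (a + b)
    regroup = solve-∀

  oddBinomialSeries≤4^ : ∀ N j → oddBinomialSeries N j ≤ 4 ^ N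
  oddBinomialSeries≤4^ N j = ≤-trans (m≤m+n _ _) (oddBinomialSeries+binomialPrefix≤4^ N j)

  weightedOddBinomialSum≤ : ∀ (x : ℕ → ℕ) A N j → (∀ s → x s * 4 ^ s ≤ A) →
    sum1 N (λ s → x s * ((2 * s ∸ 1) C j)) * 4 ^ N ≤ A * oddBinomialSeries N j
  weightedOddBinomialSum≤ x A zero    j x≤ = z≤n
  weightedOddBinomialSum≤ x A (suc N) j x≤ = begin
    (S + x (suc N) * b) * (4 * 4 ^ N)
      ≡⟨ regroup S (x (suc N)) b (4 ^ N) ⟩
    4 * (S * 4 ^ N) + b * (x (suc N) * (4 * 4 ^ N))
      ≤⟨ +-mono-≤ (*-monoʳ-≤ 4 (weightedOddBinomialSum≤ x A N j x≤)) (*-monoʳ-≤ b (x≤ (suc N))) ⟩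
    4 * (A * oddBinomialSeries N j) + b * A
      ≡⟨ regroup′ A (oddBinomialSeries N j) b ⟩
    A * (4 * oddBinomialSeries N j + b)
      ≡⟨ cong (λ n → A * (4 * oddBinomialSeries N j + (n ∸ 1) C j)) (*-suc 2 N) ⟩
    A * oddBinomialSeries (suc N) j ∎
    where
    open ≤-Reasoning
    S = sum1 N (λ s → x s * ((2 * s ∸ 1) C j))
    b = (2 * suc N ∸ 1) C j
    regroup : ∀ S y c X → (S + y * c) * (4 * X) ≡ 4 * (S * X) + c * (y * (4 * X))
    regroup = solve-∀
    regroup′ : ∀ a f c → 4 * (a * f) + c * a ≡ a * (4 * f + c)
    regroup′ = solve-∀

  tf*4^r≤4^k : ∀ f k r → tf f k r * 4 ^ r ≤ 4 ^ k
  tf*4^r≤4^k zero    k                   r             = z≤n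
  tf*4^r≤4^k (suc f) zero                r             = z≤n
  tf*4^r≤4^k (suc f) (suc k)             zero          = z≤n
  tf*4^r≤4^k (suc f) (suc zero)          (suc zero)    = ≤-refl
  tf*4^r≤4^k (suc f) (suc zero)          (suc (suc r)) = z≤n
  tf*4^r≤4^k (suc f) n@(suc (suc k))     (suc r)       with n <ᵇ suc r in eq
  ... | true  = z≤n
  ... | false = begin
    S * 4 ^ suc r          ≤⟨ *-monoˡ-≤ (4 ^ suc r) S≤4^m ⟩
    4 ^ m * 4 ^ suc r      ≡⟨ sym (^-distribˡ-+-* 4 m (suc r)) ⟩
    4 ^ (m + suc r)        ≡⟨ cong (4 ^_) (m∸n+n≡m r<n) ⟩
    4 ^ n                  ∎
    where
    open ≤-Reasoning
    m = n ∸ suc r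
    r<n : suc r ≤ n
    r<n = ≮⇒≥ (λ n<r → subst T eq (<⇒<ᵇ n<r))
    S = sum1 n (λ s → tf f m s * ((2 * s ∸ 1) C r))
    S≤4^m : S ≤ 4 ^ m
    S≤4^m = *-cancelʳ-≤ S (4 ^ m) (4 ^ n) {{m^n≢0 4 n}} (begin
      S * 4 ^ n                          ≤⟨ weightedOddBinomialSum≤ (tf f m) (4 ^ m) n r (tf*4^r≤4^k f m) ⟩
      4 ^ m * oddBinomialSeries n r      ≤⟨ *-monoʳ-≤ (4 ^ m) (oddBinomialSeries≤4^ n r) ⟩
      4 ^ m * 4 ^ n                      ∎)

  t*4^r≤4^k : ∀ k r → t k r * 4 ^ r ≤ 4 ^ k
  t*4^r≤4^k k = tf*4^r≤4^k (suc k) k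

  3*sum*4^N+A≤A*4^N : ∀ (x : ℕ → ℕ) A N → (∀ r → x r * 4 ^ r ≤ A) → 3 * sum1 N x * 4 ^ N + A ≤ A * 4 ^ N
  3*sum*4^N+A≤A*4^N x A zero    x≤ = ≤-reflexive (sym (*-identityʳ A))
  3*sum*4^N+A≤A*4^N x A (suc N) x≤ = begin
    3 * (S + x (suc N)) * (4 * 4 ^ N) + A
      ≡⟨ regroup S (x (suc N)) (4 ^ N) A ⟩
    4 * (3 * S * 4 ^ N) + 3 * (x (suc N) * (4 * 4 ^ N)) + A
      ≤⟨ +-monoˡ-≤ A (+-monoʳ-≤ (4 * (3 * S * 4 ^ N)) (*-monoʳ-≤ 3 (x≤ (suc N)))) ⟩
    4 * (3 * S * 4 ^ N) + 3 * A + A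
      ≡⟨ regroup′ (3 * S * 4 ^ N) A ⟩
    4 * (3 * S * 4 ^ N + A)
      ≤⟨ *-monoʳ-≤ 4 (3*sum*4^N+A≤A*4^N x A N x≤) ⟩
    4 * (A * 4 ^ N)
      ≡⟨ x∙yz≈y∙xz 4 A (4 ^ N) ⟩
    A * (4 * 4 ^ N) ∎
    where
    open ≤-Reasoning
    S = sum1 N x
    regroup : ∀ S y B A → 3 * (S + y) * (4 * B) + A ≡ 4 * (3 * S * B) + 3 * (y * (4 * B)) + A
    regroup = solve-∀
    regroup′ : ∀ y a → 4 * y + 3 * a + a ≡ 4 * (y + a)
    regroup′ = solve-∀

  rowSum<4^ : ∀ k → sum1 k (t k) < 4 ^ k
  rowSum<4^ k = *-cancelʳ-≤ (suc U) (4 ^ k) (4 ^ k) {{m^n≢0 4 k}} (begin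
    suc U * 4 ^ k          ≤⟨ *-monoˡ-≤ (4 ^ k) (s≤s (m≤n*m U 3)) ⟩
    suc (3 * U) * 4 ^ k    ≡⟨ +-comm (4 ^ k) _ ⟩
    3 * U * 4 ^ k + 4 ^ k  ≤⟨ 3*sum*4^N+A≤A*4^N (t k) (4 ^ k) k (t*4^r≤4^k k) ⟩
    4 ^ k * 4 ^ k          ∎)
    where
    open ≤-Reasoning
    U = sum1 k (t k)

  -- Binomial coefficients

  C-pos : ∀ {n k} → k ≤ n → 0 < n C k
  C-pos {n}     {zero}  _         = s≤s z≤n
  C-pos {suc n} {suc k} (s≤s k≤n) = begin-strict
    0                         <⟨ C-pos k≤n ⟩
    n C k                     ≤⟨ m≤m+n (n C k) (n C suc k) ⟩
    n C k + n C suc k         ≡⟨ nCk+nC[k+1]≡[n+1]C[k+1] n k ⟩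
    suc n C suc k             ∎
    where open ≤-Reasoning

  C-mirror : ∀ k j {n} → k + j ≡ n → n C k ≡ n C j
  C-mirror k j refl = trans (nCk≡nC[n∸k] (m≤m+n k j)) (cong ((k + j) C_) (m+n∸m≡n k j))

  [k+1]*[n+1]C[k+1]≡[n+1]*nCk : ∀ n k → suc k * (suc n C suc k) ≡ suc n * (n C k)
  [k+1]*[n+1]C[k+1]≡[n+1]*nCk zero    zero    = refl
  [k+1]*[n+1]C[k+1]≡[n+1]*nCk zero    (suc k) rewrite k>n⇒nCk≡0 {1} {suc (suc k)} (s≤s (s≤s z≤n)) = *-zeroʳ (suc (suc k))
  [k+1]*[n+1]C[k+1]≡[n+1]*nCk (suc n) zero    = trans (+-identityʳ _) (trans (nC1≡n (suc (suc n))) (sym (*-identityʳ _)))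
  [k+1]*[n+1]C[k+1]≡[n+1]*nCk (suc n) (suc k) = begin
      suc (suc k) * (suc (suc n) C suc (suc k))
        ≡⟨ cong (suc (suc k) *_) (sym (nCk+nC[k+1]≡[n+1]C[k+1] (suc n) (suc k))) ⟩
      suc (suc k) * (suc n C suc k + suc n C suc (suc k))
        ≡⟨ regroup (suc k) (suc n C suc k) (suc n C suc (suc k)) ⟩
      suc n C suc k + suc k * (suc n C suc k) + suc (suc k) * (suc n C suc (suc k))
        ≡⟨ cong₂ (λ a b → suc n C suc k + a + b) ([k+1]*[n+1]C[k+1]≡[n+1]*nCk n k) ([k+1]*[n+1]C[k+1]≡[n+1]*nCk n (suc k)) ⟩
      suc n C suc k + suc n * (n C k) + suc n * (n C suc k)
        ≡⟨ trans (+-assoc (suc n C suc k) _ _) (cong (suc n C suc k +_) (sym (*-distribˡ-+ (suc n) (n C k) (n C suc k)))) ⟩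
      suc n C suc k + suc n * (n C k + n C suc k)
        ≡⟨ cong (λ x → suc n C suc k + suc n * x) (nCk+nC[k+1]≡[n+1]C[k+1] n k) ⟩
      suc (suc n) * (suc n C suc k) ∎
    where
    open ≡-Reasoning
    regroup : ∀ k x y → suc k * (x + y) ≡ x + k * x + suc k * y
    regroup = solve-∀

  centralBinomial : ℕ → ℕ
  centralBinomial v = suc (2 * v) C v

  2[1+v]∸1≡1+2v : ∀ v → 2 * suc v ∸ 1 ≡ suc (2 * v)
  2[1+v]∸1≡1+2v v = cong (_∸ 1) (*-suc 2 v)

  centralBinomial-suc : ∀ v → suc (suc v) * centralBinomial (suc v) ≡ 2 * (3 + 2 * v) * centralBinomial v
  centralBinomial-suc v = *-cancelˡ-≡ _ _ (suc v) (begin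
      suc v * (suc (suc v) * centralBinomial (suc v))
        ≡⟨ cong (λ n → suc v * (suc (suc v) * (suc n C suc v))) (*-suc 2 v) ⟩
      suc v * (suc (suc v) * ((3 + 2 * v) C suc v))
        ≡⟨ x∙yz≈y∙xz (suc v) (suc (suc v)) ((3 + 2 * v) C suc v) ⟩
      suc (suc v) * (suc v * ((3 + 2 * v) C suc v))
        ≡⟨ cong (suc (suc v) *_) ([k+1]*[n+1]C[k+1]≡[n+1]*nCk (2 + 2 * v) v) ⟩
      suc (suc v) * ((3 + 2 * v) * ((2 + 2 * v) C v))
        ≡⟨ cong (λ x → suc (suc v) * ((3 + 2 * v) * x)) (C-mirror v (2 + v) (v+[2+v]≡2+2v v)) ⟩
      suc (suc v) * ((3 + 2 * v) * ((2 + 2 * v) C (2 + v)))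
        ≡⟨ x∙yz≈y∙xz (suc (suc v)) (3 + 2 * v) ((2 + 2 * v) C (2 + v)) ⟩
      (3 + 2 * v) * (suc (suc v) * ((2 + 2 * v) C (2 + v)))
        ≡⟨ cong ((3 + 2 * v) *_) ([k+1]*[n+1]C[k+1]≡[n+1]*nCk (1 + 2 * v) (1 + v)) ⟩
      (3 + 2 * v) * ((2 + 2 * v) * ((1 + 2 * v) C (1 + v)))
        ≡⟨ cong (λ x → (3 + 2 * v) * ((2 + 2 * v) * x)) (C-mirror (1 + v) v ([1+v]+v≡1+2v v)) ⟩
      (3 + 2 * v) * ((2 + 2 * v) * centralBinomial v)
        ≡⟨ regroup v (centralBinomial v) ⟩
      suc v * (2 * (3 + 2 * v) * centralBinomial v) ∎)
    where
    open ≡-Reasoning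
    v+[2+v]≡2+2v : ∀ v → v + (2 + v) ≡ 2 + 2 * v
    v+[2+v]≡2+2v = solve-∀
    [1+v]+v≡1+2v : ∀ v → (1 + v) + v ≡ 1 + 2 * v
    [1+v]+v≡1+2v = solve-∀
    regroup : ∀ v a → (3 + 2 * v) * ((2 + 2 * v) * a) ≡ suc v * (2 * (3 + 2 * v) * a)
    regroup = solve-∀

  4^≤centralBinomial : ∀ v → 4 ^ suc v ≤ 4 * suc v * centralBinomial v
  4^≤centralBinomial zero    = ≤-refl
  4^≤centralBinomial (suc v) = begin
    4 * 4 ^ suc v                                     ≤⟨ *-monoʳ-≤ 4 (4^≤centralBinomial v) ⟩
    4 * (4 * suc v * centralBinomial v)               ≤⟨ *-monoʳ-≤ 4 (*-monoˡ-≤ (centralBinomial v) 4[1+v]≤2[3+2v]) ⟩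
    4 * (2 * (3 + 2 * v) * centralBinomial v)         ≡⟨ cong (4 *_) (sym (centralBinomial-suc v)) ⟩
    4 * (suc (suc v) * centralBinomial (suc v))       ≡⟨ sym (*-assoc 4 (suc (suc v)) (centralBinomial (suc v))) ⟩
    4 * suc (suc v) * centralBinomial (suc v)         ∎
    where
    open ≤-Reasoning
    4[1+v]≤2[3+2v] : 4 * suc v ≤ 2 * (3 + 2 * v)
    4[1+v]≤2[3+2v] = ≤-trans (m≤m+n (4 * suc v) 2) (≤-reflexive (lemma v))
      where
      lemma : ∀ v → 4 * suc v + 2 ≡ 2 * (3 + 2 * v)
      lemma = solve-∀

  -- Lower bound

  seedRow : ℕ → ℕ
  seedRow zero    = 1
  seedRow (suc v) = seedRow v + suc (suc v)

  t-seed : ∀ v → 1 ≤ t (seedRow v) (suc v)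
  t-seed zero    = ≤-refl
  t-seed (suc v) = begin
    1                                                         ≤⟨ *-mono-≤ (t-seed v) binomial-pos ⟩
    t (seedRow v) (suc v) * ((2 * suc v ∸ 1) C suc v)         ≤⟨ t-step (seedRow v) (suc v) (suc v) ⟩
    t (seedRow (suc v)) (suc (suc v))                         ∎
    where
    open ≤-Reasoning
    binomial-pos : 1 ≤ (2 * suc v ∸ 1) C suc v
    binomial-pos rewrite 2[1+v]∸1≡1+2v v = C-pos (s≤s (m≤m+n v _))

  t-pump : ∀ v M → centralBinomial v ^ M ≤ t (seedRow v + M * suc v) (suc v)
  t-pump v zero    rewrite +-identityʳ (seedRow v) = t-seed v
  t-pump v (suc M) = begin
    centralBinomial v ^ suc M                               ≡⟨ *-comm (centralBinomial v) _ ⟩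
    centralBinomial v ^ M * centralBinomial v               ≤⟨ *-monoˡ-≤ _ (t-pump v M) ⟩
    t K (suc v) * centralBinomial v                         ≡⟨ cong (λ n → t K (suc v) * (n C v)) (sym (2[1+v]∸1≡1+2v v)) ⟩
    t K (suc v) * ((2 * suc v ∸ 1) C v)                     ≤⟨ t-step K v (suc v) ⟩
    t (K + suc v) (suc v)                                   ≡⟨ cong (λ K → t K (suc v)) (+-assoc (seedRow v) (M * suc v) (suc v)) ⟩
    t (seedRow v + (M * suc v + suc v)) (suc v)             ≡⟨ cong (λ n → t (seedRow v + n) (suc v)) (+-comm (M * suc v) (suc v)) ⟩
    t (seedRow v + suc M * suc v) (suc v)                   ∎
    where
    open ≤-Reasoning
    K = seedRow v + M * suc v

  t-descend : ∀ K s → t K s ≤ t (K + 1) 1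
  t-descend K s = subst (_≤ t (K + 1) 1) (*-identityʳ (t K s)) (t-step K 0 s)

  t-firstColumn-mono : ∀ K d → t K 1 ≤ t (K + d) 1
  t-firstColumn-mono K zero    rewrite +-identityʳ K = ≤-refl
  t-firstColumn-mono K (suc d) = begin
    t K 1               ≤⟨ t-firstColumn-mono K d ⟩
    t (K + d) 1         ≤⟨ t-descend (K + d) 1 ⟩
    t (K + d + 1) 1     ≡⟨ cong (λ n → t n 1) (trans (+-assoc K d 1) (cong (K +_) (+-comm d 1))) ⟩
    t (K + suc d) 1     ∎
    where open ≤-Reasoning

  t-firstColumn-lower : ∀ v M d → centralBinomial v ^ M ≤ t (seedRow v + M * suc v + suc d) 1
  t-firstColumn-lower v M d = begin
    centralBinomial v ^ M   ≤⟨ t-pump v M ⟩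
    t K (suc v)             ≤⟨ t-descend K (suc v) ⟩
    t (K + 1) 1             ≤⟨ t-firstColumn-mono (K + 1) d ⟩
    t (K + 1 + d) 1         ≡⟨ cong (λ n → t n 1) (+-assoc K 1 d) ⟩
    t (K + suc d) 1         ∎
    where
    open ≤-Reasoning
    K = seedRow v + M * suc v

  [m*n]^k≡m^k*n^k : ∀ m n k → (m * n) ^ k ≡ m ^ k * n ^ k
  [m*n]^k≡m^k*n^k m n zero    = refl
  [m*n]^k≡m^k*n^k m n (suc k) = begin
    m * n * (m * n) ^ k        ≡⟨ cong (m * n *_) ([m*n]^k≡m^k*n^k m n k) ⟩
    m * n * (m ^ k * n ^ k)    ≡⟨ interchange m n (m ^ k) (n ^ k) ⟩
    m * m ^ k * (n * n ^ k)    ∎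
    where open ≡-Reasoning

  [b+m]*b^m≤b*[1+b]^m : ∀ b m → (b + m) * b ^ m ≤ b * suc b ^ m
  [b+m]*b^m≤b*[1+b]^m b zero    = ≤-reflexive (cong (_* 1) (+-identityʳ b))
  [b+m]*b^m≤b*[1+b]^m b (suc m) = begin
    (b + suc m) * (b * b ^ m)                   ≤⟨ m≤m+n _ (m * b ^ m) ⟩
    (b + suc m) * (b * b ^ m) + m * b ^ m       ≡⟨ regroup b m (b ^ m) ⟩
    suc b * ((b + m) * b ^ m)                   ≤⟨ *-monoʳ-≤ (suc b) ([b+m]*b^m≤b*[1+b]^m b m) ⟩
    suc b * (b * suc b ^ m)                     ≡⟨ x∙yz≈y∙xz (suc b) b (suc b ^ m) ⟩
    b * (suc b * suc b ^ m)                     ∎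
    where
    open ≤-Reasoning
    regroup : ∀ b m x → (b + suc m) * (b * x) + m * x ≡ suc b * ((b + m) * x)
    regroup = solve-∀

  2^j*b^[b*j]≤[1+b]^[b*j] : ∀ b j .{{_ : NonZero b}} → 2 ^ j * b ^ (b * j) ≤ suc b ^ (b * j)
  2^j*b^[b*j]≤[1+b]^[b*j] b j = begin
    2 ^ j * b ^ (b * j)      ≡⟨ cong (2 ^ j *_) (sym (^-*-assoc b b j)) ⟩
    2 ^ j * (b ^ b) ^ j      ≡⟨ sym ([m*n]^k≡m^k*n^k 2 (b ^ b) j) ⟩
    (2 * b ^ b) ^ j          ≤⟨ ^-monoˡ-≤ j 2*b^b≤[1+b]^b ⟩
    (suc b ^ b) ^ j          ≡⟨ ^-*-assoc (suc b) b j ⟩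
    suc b ^ (b * j)          ∎
    where
    open ≤-Reasoning
    2*b^b≤[1+b]^b : 2 * b ^ b ≤ suc b ^ b
    2*b^b≤[1+b]^b = *-cancelˡ-≤ b (begin
      b * (2 * b ^ b)        ≡⟨ regroup b (b ^ b) ⟩
      (b + b) * b ^ b        ≤⟨ [b+m]*b^m≤b*[1+b]^m b b ⟩
      b * suc b ^ b          ∎)
      where
      regroup : ∀ b x → b * (2 * x) ≡ (b + b) * x
      regroup = solve-∀

  [4+i]²≤2^[4+i] : ∀ i → (4 + i) * (4 + i) ≤ 2 ^ (4 + i)
  [4+i]²≤2^[4+i] zero    = ≤-refl
  [4+i]²≤2^[4+i] (suc i) = begin
    (5 + i) * (5 + i)                           ≤⟨ m≤m+n _ (7 + 6 * i + i * i) ⟩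
    (5 + i) * (5 + i) + (7 + 6 * i + i * i)     ≡⟨ regroup i ⟩
    2 * ((4 + i) * (4 + i))                     ≤⟨ *-monoʳ-≤ 2 ([4+i]²≤2^[4+i] i) ⟩
    2 * 2 ^ (4 + i)                             ∎
    where
    open ≤-Reasoning
    regroup : ∀ i → (5 + i) * (5 + i) + (7 + 6 * i + i * i) ≡ 2 * ((4 + i) * (4 + i))
    regroup = solve-∀

  n<2^n : ∀ n → n < 2 ^ n
  n<2^n zero    = s≤s z≤n
  n<2^n (suc n) = ≤-trans (+-mono-≤ (m^n>0 2 n) (n<2^n n)) (≤-reflexive (cong (2 ^ n +_) (sym (+-identityʳ (2 ^ n)))))

  euclidean-split : ∀ R w .{{_ : NonZero w}} M₀ k → suc R + M₀ * w ≤ k →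
    Σ ℕ λ M → Σ ℕ λ r → k ≡ R + M * w + suc r × r < w × M₀ ≤ M
  euclidean-split R w M₀ k le = d / w , d % w , k≡ , m%n<n d w , M₀≤M
    where
    d = k ∸ suc R
    k≡ : k ≡ R + d / w * w + suc (d % w)
    k≡ = begin
      k                                   ≡⟨ sym (m+[n∸m]≡n (≤-trans (m≤m+n (suc R) (M₀ * w)) le)) ⟩
      suc R + d                           ≡⟨ cong (suc R +_) (m≡m%n+[m/n]*n d w) ⟩
      suc R + (d % w + d / w * w)         ≡⟨ regroup R (d % w) (d / w * w) ⟩
      R + d / w * w + suc (d % w)         ∎
      where
      open ≡-Reasoning
      regroup : ∀ R r x → suc R + (r + x) ≡ R + x + suc r
      regroup = solve-∀
    M₀≤M : M₀ ≤ d / w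
    M₀≤M = subst (_≤ d / w) (m*n/n≡m M₀ w)
             (/-monoˡ-≤ w (subst (_≤ d) (m+n∸m≡n (suc R) (M₀ * w)) (∸-monoˡ-≤ (suc R) le)))

  eventually-pow< : ∀ (f : ℕ → ℕ) b n w E R .{{_ : NonZero b}} .{{_ : NonZero n}} .{{_ : NonZero w}} →
    2 * b ^ w ≤ E * n ^ w → (∀ M d → E ^ M ≤ f (R + M * w + suc d)) →
    Σ ℕ λ N → ∀ k → N ≤ k → b ^ k < f k * n ^ k
  eventually-pow< f b n w E R 2b^w≤En^w E^M≤f = suc R + M₀ * w , bound
    where
    -- Writing k = R + M w + suc r, the hypotheses give f k · n^k ≥ 2^M · b^(M w), and
    -- M ≥ M₀ makes 2^M exceed the remaining factor b^(R + suc r) ≤ b^X.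
    X = R + w
    M₀ = b * X
    instance
      X≢0 : NonZero X
      X≢0 = >-nonZero (≤-trans (>-nonZero⁻¹ w) (m≤n+m w R))
    b^X<2^M₀ : b ^ X < 2 ^ M₀
    b^X<2^M₀ = begin-strict
      b ^ X          <⟨ ^-monoˡ-< X (n<2^n b) ⟩
      (2 ^ b) ^ X    ≡⟨ ^-*-assoc 2 b X ⟩
      2 ^ M₀         ∎
      where open ≤-Reasoning
    bound : ∀ k → suc R + M₀ * w ≤ k → b ^ k < f k * n ^ k
    bound k le with euclidean-split R w M₀ k le
    ... | M , r , refl , r<w , M₀≤M = begin-strict
      b ^ (R + M * w + suc r)        ≤⟨ ^-monoʳ-≤ b k≤X+Mw ⟩
      b ^ (X + M * w)                ≡⟨ ^-distribˡ-+-* b X (M * w) ⟩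
      b ^ X * b ^ (M * w)            <⟨ *-monoˡ-< (b ^ (M * w)) {{m^n≢0 b (M * w)}} b^X<2^M₀ ⟩
      2 ^ M₀ * b ^ (M * w)           ≤⟨ *-monoˡ-≤ (b ^ (M * w)) (^-monoʳ-≤ 2 M₀≤M) ⟩
      2 ^ M * b ^ (M * w)            ≡⟨ cong (2 ^ M *_) (trans (cong (b ^_) (*-comm M w)) (sym (^-*-assoc b w M))) ⟩
      2 ^ M * (b ^ w) ^ M            ≡⟨ sym ([m*n]^k≡m^k*n^k 2 (b ^ w) M) ⟩
      (2 * b ^ w) ^ M                ≤⟨ ^-monoˡ-≤ M 2b^w≤En^w ⟩
      (E * n ^ w) ^ M                ≡⟨ [m*n]^k≡m^k*n^k E (n ^ w) M ⟩
      E ^ M * (n ^ w) ^ M            ≡⟨ cong (E ^ M *_) (trans (^-*-assoc n w M) (cong (n ^_) (*-comm w M))) ⟩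
      E ^ M * n ^ (M * w)            ≤⟨ *-mono-≤ (E^M≤f M r) (^-monoʳ-≤ n Mw≤k) ⟩
      f k * n ^ k                    ∎
      where
      open ≤-Reasoning
      k≤X+Mw : k ≤ X + M * w
      k≤X+Mw = begin
        R + M * w + suc r    ≤⟨ +-monoʳ-≤ (R + M * w) r<w ⟩
        R + M * w + w        ≡⟨ regroup R (M * w) w ⟩
        X + M * w            ∎
        where
        regroup : ∀ R x w → R + x + w ≡ R + w + x
        regroup = solve-∀
      Mw≤k : M * w ≤ k
      Mw≤k = ≤-trans (m≤n+m (M * w) R) (m≤m+n _ (suc r))

  firstColumn-eventually> : ∀ m → Σ ℕ λ N → ∀ k → N ≤ k → (3 + 4 * m) ^ k < t k 1 * suc m ^ k
  firstColumn-eventually> m =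
    eventually-pow< (λ k → t k 1) b (suc m) w (centralBinomial v) (seedRow v) 2b^w≤En^w (t-firstColumn-lower v)
    where
    b = 3 + 4 * m
    j = 4 + 8 * b
    -- b * j is a successor, so w ≡ b * j definitionally
    v = pred (b * j)
    w = suc v
    E = centralBinomial v
    8w≤2^j : 8 * w ≤ 2 ^ j
    8w≤2^j = begin
      8 * (b * j)      ≡⟨ sym (*-assoc 8 b j) ⟩
      8 * b * j        ≤⟨ *-monoˡ-≤ j (m≤n+m (8 * b) 4) ⟩
      j * j            ≤⟨ [4+i]²≤2^[4+i] (8 * b) ⟩
      2 ^ j            ∎
      where open ≤-Reasoning
    2b^w≤En^w : 2 * b ^ w ≤ E * suc m ^ w
    2b^w≤En^w = *-cancelˡ-≤ (4 * w) (begin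
      4 * w * (2 * b ^ w)          ≡⟨ regroup w (b ^ w) ⟩
      8 * w * b ^ w                ≤⟨ *-monoˡ-≤ (b ^ w) 8w≤2^j ⟩
      2 ^ j * b ^ w                ≤⟨ 2^j*b^[b*j]≤[1+b]^[b*j] b j ⟩
      suc b ^ w                    ≡⟨ cong (_^ w) (1+[3+4m]≡4[1+m] m) ⟩
      (4 * suc m) ^ w              ≡⟨ [m*n]^k≡m^k*n^k 4 (suc m) w ⟩
      4 ^ w * suc m ^ w            ≤⟨ *-monoˡ-≤ (suc m ^ w) (4^≤centralBinomial v) ⟩
      4 * w * E * suc m ^ w        ≡⟨ *-assoc (4 * w) E (suc m ^ w) ⟩
      4 * w * (E * suc m ^ w)      ∎)
      where
      open ≤-Reasoning
      regroup : ∀ w x → 4 * w * (2 * x) ≡ 8 * w * x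
      regroup = solve-∀
      1+[3+4m]≡4[1+m] : ∀ m → suc (3 + 4 * m) ≡ 4 * suc m
      1+[3+4m]≡4[1+m] = solve-∀

module _ where
  open import Data.Nat as ℕ using (ℕ; zero; suc; z≤n; s≤s)
  import Data.Nat.Properties as ℕ
  open import Data.Integer as ℤ using (+_; -[1+_]; +≤+; +<+)
  import Data.Integer.Properties as ℤ
  open import Data.Rational
  open import Data.Rational.Properties
  import Data.Rational.Unnormalised as ℚᵘ
  import Data.Rational.Unnormalised.Properties as ℚᵘ
  open import Data.Nat.Coprimality using (1-coprimeTo) renaming (sym to coprime-sym)
  open import Algebra.Bundles using (CommutativeMonoid)
  open import Algebra.Properties.CommutativeSemigroup (CommutativeMonoid.commutativeSemigroup *-1-commutativeMonoid)
    using (interchange)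
  open import Data.Product using (Σ; _,_)
  open import Data.Empty using (⊥-elim)
  open import Data.Nat.Tactic.RingSolver using (solve-∀)
  open import Relation.Binary.PropositionalEquality

  -- Rational estimates

  +m/d≤+n/e : ∀ m n d e .{{_ : ℕ.NonZero d}} .{{_ : ℕ.NonZero e}} → m ℕ.* e ℕ.≤ n ℕ.* d → (+ m) / d ≤ (+ n) / e
  +m/d≤+n/e m n d@(suc d-1) e@(suc e-1) le = toℚᵘ-cancel-≤
    (ℚᵘ.≤-respˡ-≃ (ℚᵘ.≃-sym (toℚᵘ-fromℚᵘ (ℚᵘ.mkℚᵘ (+ m) d-1)))
    (ℚᵘ.≤-respʳ-≃ (ℚᵘ.≃-sym (toℚᵘ-fromℚᵘ (ℚᵘ.mkℚᵘ (+ n) e-1)))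
    (ℚᵘ.*≤* (subst₂ ℤ._≤_ (ℤ.pos-* m e) (ℤ.pos-* n d) (+≤+ le)))))

  +m/d<+n/e : ∀ m n d e .{{_ : ℕ.NonZero d}} .{{_ : ℕ.NonZero e}} → m ℕ.* e ℕ.< n ℕ.* d → (+ m) / d < (+ n) / e
  +m/d<+n/e m n d@(suc d-1) e@(suc e-1) lt = toℚᵘ-cancel-<
    (ℚᵘ.<-respˡ-≃ (ℚᵘ.≃-sym (toℚᵘ-fromℚᵘ (ℚᵘ.mkℚᵘ (+ m) d-1)))
    (ℚᵘ.<-respʳ-≃ (ℚᵘ.≃-sym (toℚᵘ-fromℚᵘ (ℚᵘ.mkℚᵘ (+ n) e-1)))
    (ℚᵘ.*<* (subst₂ ℤ._<_ (ℤ.pos-* m e) (ℤ.pos-* n d) (+<+ lt)))))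

  fromℕ : ℕ → ℚ
  fromℕ n = (+ n) / 1

  fromℕ≡mkℚ : ∀ n → fromℕ n ≡ mkℚ (+ n) 0 (coprime-sym (1-coprimeTo n))
  fromℕ≡mkℚ n = ↥p/↧p≡p (mkℚ (+ n) 0 (coprime-sym (1-coprimeTo n)))

  fromℕ-mono-≤ : ∀ {m n} → m ℕ.≤ n → fromℕ m ≤ fromℕ n
  fromℕ-mono-≤ {m} {n} m≤n = +m/d≤+n/e m n 1 1 (ℕ.*-monoˡ-≤ 1 m≤n)

  fromℕ-mono-< : ∀ {m n} → m ℕ.< n → fromℕ m < fromℕ n
  fromℕ-mono-< {m} {n} m<n = +m/d<+n/e m n 1 1 (ℕ.*-monoˡ-< 1 m<n)

  fromℕ-homo-+ : ∀ m n → fromℕ (m ℕ.+ n) ≡ fromℕ m + fromℕ n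
  fromℕ-homo-+ m n rewrite fromℕ≡mkℚ m | fromℕ≡mkℚ n = /-cong {+ (m ℕ.+ n)} m+n≡m*1+n*1 refl
    where
    m+n≡m*1+n*1 : + (m ℕ.+ n) ≡ + m ℤ.* + 1 ℤ.+ + n ℤ.* + 1
    m+n≡m*1+n*1 = trans (ℤ.pos-+ m n) (sym (cong₂ ℤ._+_ (ℤ.*-identityʳ (+ m)) (ℤ.*-identityʳ (+ n))))

  fromℕ-homo-* : ∀ m n → fromℕ (m ℕ.* n) ≡ fromℕ m * fromℕ n
  fromℕ-homo-* m n rewrite fromℕ≡mkℚ m | fromℕ≡mkℚ n = /-cong {+ (m ℕ.* n)} (ℤ.pos-* m n) refl

  fromℕ-homo-^ : ∀ m k → fromℕ (m ℕ.^ k) ≡ fromℕ m ^ℚ k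
  fromℕ-homo-^ m zero    = refl
  fromℕ-homo-^ m (suc k) = trans (fromℕ-homo-* m (m ℕ.^ k)) (cong (fromℕ m *_) (fromℕ-homo-^ m k))

  ^ℚ-distrib-* : ∀ p q k → (p * q) ^ℚ k ≡ p ^ℚ k * q ^ℚ k
  ^ℚ-distrib-* p q zero    = sym (*-identityˡ 1ℚ)
  ^ℚ-distrib-* p q (suc k) = trans (cong ((p * q) *_) (^ℚ-distrib-* p q k)) (interchange p q (p ^ℚ k) (q ^ℚ k))

  ^ℚ-nonNeg : ∀ p k → 0ℚ ≤ p → 0ℚ ≤ p ^ℚ k
  ^ℚ-nonNeg p zero    _   = fromℕ-mono-≤ {0} {1} z≤n
  ^ℚ-nonNeg p (suc k) 0≤p = ≤-trans (≤-reflexive (sym (*-zeroˡ (p ^ℚ k))))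
                              (*-monoʳ-≤-nonNeg (p ^ℚ k) {{nonNegative (^ℚ-nonNeg p k 0≤p)}} 0≤p)

  ^ℚ-monoˡ-≤ : ∀ k {p q} → 0ℚ ≤ p → p ≤ q → p ^ℚ k ≤ q ^ℚ k
  ^ℚ-monoˡ-≤ zero    _   _   = ≤-refl
  ^ℚ-monoˡ-≤ (suc k) {p} {q} 0≤p p≤q =
    ≤-trans (*-monoʳ-≤-nonNeg (p ^ℚ k) {{nonNegative (^ℚ-nonNeg p k 0≤p)}} p≤q)
            (*-monoˡ-≤-nonNeg q {{nonNegative (≤-trans 0≤p p≤q)}} (^ℚ-monoˡ-≤ k 0≤p p≤q))

  sum1ℚ≤fromℕ-sum1 : ∀ K (g : ℕ → ℚ) (h : ℕ → ℕ) → (∀ r → g r ≤ fromℕ (h r)) → sum1ℚ K g ≤ fromℕ (sum1 K h)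
  sum1ℚ≤fromℕ-sum1 zero    g h g≤h = ≤-refl
  sum1ℚ≤fromℕ-sum1 (suc K) g h g≤h = ≤-trans (+-mono-≤ (sum1ℚ≤fromℕ-sum1 K g h g≤h) (g≤h (suc K)))
                                             (≤-reflexive (sym (fromℕ-homo-+ (sum1 K h) (h (suc K)))))

  first≤sum1ℚ : ∀ K (g : ℕ → ℚ) → (∀ r → 0ℚ ≤ g r) → g 1 ≤ sum1ℚ (suc K) g
  first≤sum1ℚ zero    g 0≤g = ≤-reflexive (sym (+-identityˡ (g 1)))
  first≤sum1ℚ (suc K) g 0≤g = ≤-trans (first≤sum1ℚ K g 0≤g)
    (≤-trans (≤-reflexive (sym (+-identityʳ _))) (+-monoʳ-≤ (sum1ℚ (suc K) g) (0≤g (suc (suc K)))))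

  c≤rowSum : ∀ k → c k ≤ fromℕ (sum1 k (t k))
  c≤rowSum k = sum1ℚ≤fromℕ-sum1 k _ (t k) summand≤
    where
    summand≤ : ∀ r → _ ≤ fromℕ (t k r)
    summand≤ zero    = fromℕ-mono-≤ {0} {t k 0} z≤n
    summand≤ (suc r) = +m/d≤+n/e (t k (suc r)) (t k (suc r)) (suc r) 1 (ℕ.*-monoʳ-≤ (t k (suc r)) (s≤s z≤n))

  t[1+k,1]≤c[1+k] : ∀ k → fromℕ (t (suc k) 1) ≤ c (suc k)
  t[1+k,1]≤c[1+k] k = first≤sum1ℚ k _ summand≥0
    where
    summand≥0 : ∀ r → 0ℚ ≤ _
    summand≥0 zero    = ≤-refl
    summand≥0 (suc r) = +m/d≤+n/e 0 (t (suc k) (suc r)) 1 (suc r) z≤n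

  archimedean : ∀ ε → 0ℚ < ε → Σ ℕ λ m → 1ℚ ≤ fromℕ (suc m) * ε
  archimedean (mkℚ (+ suc p) d _) _ = d , 1≤[1+d]*ε
    where
    1≤[1+d]*ε : 1ℚ ≤ fromℕ (suc d) * _
    1≤[1+d]*ε rewrite fromℕ≡mkℚ (suc d) = subst (λ z → 1ℚ ≤ z / (1 ℕ.* suc d)) (ℤ.pos-* (suc d) (suc p))
      (+m/d≤+n/e 1 (suc d ℕ.* suc p) 1 (1 ℕ.* suc d) 1*[1*[1+d]]≤[1+d]*[1+p]*1)
      where
      1*[1*[1+d]]≤[1+d]*[1+p]*1 : 1 ℕ.* (1 ℕ.* suc d) ℕ.≤ suc d ℕ.* suc p ℕ.* 1
      1*[1*[1+d]]≤[1+d]*[1+p]*1 = subst₂ ℕ._≤_ (sym (trans (ℕ.*-identityˡ _) (ℕ.*-identityˡ _))) (sym (ℕ.*-identityʳ _))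
                                    (ℕ.m≤m*n (suc d) (suc p))
  archimedean (mkℚ (+ zero) _ _) 0<ε = ⊥-elim (ℤ.Positive.pos (positive 0<ε))
  archimedean (mkℚ -[1+ _ ] _ _) 0<ε = ⊥-elim (ℤ.Positive.pos (positive 0<ε))

  [1+m]*[4-ε]≤3+4m : ∀ m ε → 1ℚ ≤ fromℕ (suc m) * ε → fromℕ (suc m) * (four - ε) ≤ fromℕ (3 ℕ.+ 4 ℕ.* m)
  [1+m]*[4-ε]≤3+4m m ε 1≤nε = begin
    n * (four - ε)                  ≡⟨ *-distribˡ-+ n four (- ε) ⟩
    n * four + n * - ε              ≡⟨ cong (λ z → n * four + z) (sym (neg-distribʳ-* n ε)) ⟩
    n * four - n * ε                ≤⟨ +-monoʳ-≤ (n * four) (neg-antimono-≤ 1≤nε) ⟩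
    n * four - 1ℚ                   ≡⟨ cong (_- 1ℚ) 4n≡b+1 ⟩
    b + 1ℚ - 1ℚ                     ≡⟨ +-assoc b 1ℚ (- 1ℚ) ⟩
    b + (1ℚ - 1ℚ)                   ≡⟨ cong (λ z → b + z) (+-inverseʳ 1ℚ) ⟩
    b + 0ℚ                          ≡⟨ +-identityʳ b ⟩
    b                               ∎
    where
    open ≤-Reasoning
    n = fromℕ (suc m)
    b = fromℕ (3 ℕ.+ 4 ℕ.* m)
    4n≡b+1 : n * four ≡ b + 1ℚ
    4n≡b+1 = begin-equality
      n * four                            ≡⟨ sym (fromℕ-homo-* (suc m) 4) ⟩
      fromℕ (suc m ℕ.* 4)                 ≡⟨ cong fromℕ ([1+m]*4≡[3+4m]+1 m) ⟩
      fromℕ (3 ℕ.+ 4 ℕ.* m ℕ.+ 1)         ≡⟨ fromℕ-homo-+ (3 ℕ.+ 4 ℕ.* m) 1 ⟩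
      b + 1ℚ                              ∎
      where
      [1+m]*4≡[3+4m]+1 : ∀ m → suc m ℕ.* 4 ≡ 3 ℕ.+ 4 ℕ.* m ℕ.+ 1
      [1+m]*4≡[3+4m]+1 = solve-∀

  ^ℚ<-by-scaling : ∀ x a b n k → 0ℚ ≤ x → fromℕ n * x ≤ fromℕ b →
    b ℕ.^ k ℕ.< a ℕ.* n ℕ.^ k → x ^ℚ k < fromℕ a
  ^ℚ<-by-scaling x a b n k 0≤x nx≤b b^k<an^k =
    *-cancelˡ-<-nonNeg (fromℕ (n ℕ.^ k)) {{nonNegative (fromℕ-mono-≤ {0} {n ℕ.^ k} z≤n)}} (begin-strict
      fromℕ (n ℕ.^ k) * x ^ℚ k      ≡⟨ cong (_* x ^ℚ k) (fromℕ-homo-^ n k) ⟩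
      fromℕ n ^ℚ k * x ^ℚ k         ≡⟨ sym (^ℚ-distrib-* (fromℕ n) x k) ⟩
      (fromℕ n * x) ^ℚ k            ≤⟨ ^ℚ-monoˡ-≤ k 0≤nx nx≤b ⟩
      fromℕ b ^ℚ k                  ≡⟨ sym (fromℕ-homo-^ b k) ⟩
      fromℕ (b ℕ.^ k)               <⟨ fromℕ-mono-< b^k<an^k ⟩
      fromℕ (a ℕ.* n ℕ.^ k)         ≡⟨ cong fromℕ (ℕ.*-comm a (n ℕ.^ k)) ⟩
      fromℕ (n ℕ.^ k ℕ.* a)         ≡⟨ fromℕ-homo-* (n ℕ.^ k) a ⟩
      fromℕ (n ℕ.^ k) * fromℕ a     ∎)
    where
    open ≤-Reasoning
    0≤nx : 0ℚ ≤ fromℕ n * x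
    0≤nx = ≤-trans (≤-reflexive (sym (*-zeroʳ (fromℕ n))))
                   (*-monoˡ-≤-nonNeg (fromℕ n) {{nonNegative (fromℕ-mono-≤ {0} {n} z≤n)}} 0≤x)

  c<[4+ε]^k : ∀ ε → 0ℚ ≤ ε → ∀ k → c k < (four + ε) ^ℚ k
  c<[4+ε]^k ε 0≤ε k = begin-strict
    c k                          ≤⟨ c≤rowSum k ⟩
    fromℕ (sum1 k (t k))         <⟨ fromℕ-mono-< (rowSum<4^ k) ⟩
    fromℕ (4 ℕ.^ k)              ≡⟨ fromℕ-homo-^ 4 k ⟩
    four ^ℚ k                    ≤⟨ ^ℚ-monoˡ-≤ k (fromℕ-mono-≤ {0} {4} z≤n) four≤four+ε ⟩
    (four + ε) ^ℚ k              ∎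
    where
    open ≤-Reasoning
    four≤four+ε : four ≤ four + ε
    four≤four+ε = ≤-trans (≤-reflexive (sym (+-identityʳ four))) (+-monoʳ-≤ four 0≤ε)

  [4-ε]^[1+k]<c[1+k] : ∀ ε m k → ε ≤ four → 1ℚ ≤ fromℕ (suc m) * ε →
    (3 ℕ.+ 4 ℕ.* m) ℕ.^ suc k ℕ.< t (suc k) 1 ℕ.* suc m ℕ.^ suc k → (four - ε) ^ℚ suc k < c (suc k)
  [4-ε]^[1+k]<c[1+k] ε m k ε≤4 1≤nε growth =
    <-≤-trans (^ℚ<-by-scaling (four - ε) (t (suc k) 1) _ (suc m) (suc k) 0≤4-ε ([1+m]*[4-ε]≤3+4m m ε 1≤nε) growth)
              (t[1+k,1]≤c[1+k] k)
    where
    0≤4-ε : 0ℚ ≤ four - ε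
    0≤4-ε = ≤-trans (≤-reflexive (sym (+-inverseʳ four))) (+-monoʳ-≤ four (neg-antimono-≤ ε≤4))

open import Data.Nat using (ℕ; _≥_; suc; s≤s; z≤n)
open import Data.Nat.Properties using (≤-trans; n≤1+n)
open import Data.Product using (Σ; _×_; _,_)
open import Data.Rational using (ℚ; _<_; _≤_; 0ℚ; 1ℚ; _+_; _-_)
open import Data.Rational.Properties using (<⇒≤; <-≤-trans)

mainTheorem3 : (ε : ℚ) → 0ℚ < ε → ε < 1ℚ →
    Σ ℕ (λ N → (k : ℕ) → k ≥ N →
      ((four - ε) ^ℚ k < c k) × (c k < (four + ε) ^ℚ k))
mainTheorem3 ε 0<ε ε<1 =
  let m , 1≤[1+m]ε = archimedean ε 0<ε
      N , growth   = firstColumn-eventually> m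
  in suc N , λ { (suc k) (s≤s N≤k) →
       [4-ε]^[1+k]<c[1+k] ε m k ε≤4 1≤[1+m]ε (growth (suc k) (≤-trans N≤k (n≤1+n k))) , c<[4+ε]^k ε (<⇒≤ 0<ε) (suc k) }
  where
  ε≤4 : ε ≤ four
  ε≤4 = <⇒≤ (<-≤-trans ε<1 (fromℕ-mono-≤ {1} {4} (s≤s z≤n)))
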